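{- Let $p_r(n)$ denote Ramanujan's general partition function, defined for integers $n\ge 0$ and nonzero integers $r$ by $\sum_{n=0}^\infty p_r(n)q^n=\frac{1}{(q;q)_\infty^r}$ for $|q|<1$, where $(q;q)_\infty=\prod_{k=1}^\infty(1-q^{k})$. For any integer $\lambda$ with $25\lambda+1\neq 0$, every integer $n\ge 0$, and $\ell\in\{1,2,3,4\}$, we have $p_{ -(25\lambda+1)}(25n+5\ell+1)\equiv 0\pmod 5$. -}

module Defs where

open import Data.Nat as ℕ using (ℕ; zero; suc; _≡ᵇ_)
open import Data.Integer as ℤ using (ℤ; +_; -[1+_]; _+_; _*_; -_)
open import Data.Bool using (if_then_else_)
open import Data.List using (List; []; _∷_; map; upTo; zipWith; foldr)

sumℤ : List ℤ → ℤ
sumℤ = foldr _+_ (+ 0)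

Series : Set
Series = ℕ → ℤ

one : Series
one zero    = + 1
one (suc _) = + 0

_⊛_ : Series → Series → Series
(f ⊛ g) n = sumℤ (map (λ i → f i * g (n ℕ.∸ i)) (upTo (suc n)))

infixl 7 _⊛_

pow : Series → ℕ → Series
pow f zero    = one
pow f (suc m) = f ⊛ pow f m

-- The polynomial 1 - q^k  (used for k ≥ 1).
oneMinusQ^ : ℕ → Series
oneMinusQ^ k zero    = + 1
oneMinusQ^ k (suc n) = if suc n ≡ᵇ k then -[1+ 0 ] else + 0

qPochUpTo : ℕ → Series
qPochUpTo zero    = one
qPochUpTo (suc m) = qPochUpTo m ⊛ oneMinusQ^ (suc m)

-- (q;q)_∞ = ∏_{k≥1} (1 - q^k) as a formal power series: its n-th coefficient
-- equals that of the finite product up to k = n (factors with k > n are ≡ 1 mod q^{n+1}).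
qPoch : Series
qPoch n = qPochUpTo n n

-- Multiplicative inverse of a series f with constant term 1:
-- b 0 = 1,  b (n+1) = - Σ_{i=1}^{n+1} f i * b (n+1-i).
-- invRev f n is the list [b n, b (n-1), …, b 0].
invRev : Series → ℕ → List ℤ
invRev f zero    = + 1 ∷ []
invRev f (suc n) =
  let bs = invRev f n in
  - sumℤ (zipWith _*_ (map (λ j → f (suc j)) (upTo (suc n))) bs) ∷ bs

headℤ : List ℤ → ℤ
headℤ []      = + 0
headℤ (x ∷ _) = x

-- 1 / f  (meaningful when f 0 = 1, as for (q;q)_∞).
inv : Series → Series
inv f n = headℤ (invRev f n)

-- Ramanujan's general partition function:  Σ p_r(n) q^n = 1 / (q;q)_∞^r.
-- For r = m > 0 this is (1/(q;q)_∞)^m, for r = -m < 0 it is (q;q)_∞^m.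
ramanujanP : ℤ → ℕ → ℤ
ramanujanP (+ m)      = pow (inv qPoch) m
ramanujanP -[1+ m ]   = pow qPoch (suc m)

-- Write E = (q;q)_∞. Since 25λ + 1 ≡ 1 (mod 25), the series Σ p_{-(25λ+1)}(n) qⁿ factors as h · E,
-- where h is a power of E²⁵ (for λ ≥ 0) or of E⁻²⁵ (for λ < 0). By the Frobenius congruence
-- f⁵ ≡ f(q⁵) (mod 5), every 25th power f²⁵ is congruent modulo 5 to f(q²⁵), a series in q²⁵; hence
-- modulo 5 the coefficient of q^N in h · E only involves coefficients of E at N − 25t. By Euler's
-- pentagonal number theorem, obtained coefficientwise from Shanks' finite identity, the coefficient
-- of q^e in E vanishes unless 24e + 1 is a perfect square; a square is never divisible by 5 exactly
-- once, while 5 exactly divides 24(N − 25t) + 1 for N = 25n + 5ℓ + 1 with 1 ≤ ℓ ≤ 4.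
module Submission where

open import Defs

open import Level using (0ℓ)
open import Function using (id; _∘_; flip; _⟨_⟩_)
open import Function.Bundles using (_⇔_; mk⇔; Equivalence)
open import Data.Bool using (if_then_else_)
open import Data.Maybe using (Maybe; just; nothing)
open import Data.Product using (_,_; _×_; ∃-syntax)
open import Data.Sum using ([_,_]′)
open import Data.List using (applyUpTo; zipWith)
open import Data.List.Properties using (map-applyUpTo)
open import Data.Nat as ℕ using (ℕ; zero; suc; _≤_; _<_; z≤n; s≤s; _∸_)
import Data.Nat.Properties as ℕ
import Data.Nat.Divisibility as ℕᵈ
open ℕᵈ using () renaming (_∣_ to _∣ℕ_; _∤_ to _∤ℕ_)
open import Data.Nat.Primality using (euclidsLemma; prime?)
open import Data.Nat.Tactic.RingSolver using () renaming (solve-∀ to ℕ-solve-∀)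
open import Data.Integer as ℤ using (ℤ; +_; -[1+_]; _+_; _*_; -_; _-_; _^_)
import Data.Integer.Properties as ℤ
open import Data.Integer.Divisibility.Signed
  using (_∣_; divides; ∣-refl; ∣m∣n⇒∣m+n; ∣m⇒∣-m; ∣m⇒∣m*n; ∣n⇒∣m*n; ∣⇒∣ᵤ)
import Data.Integer.Divisibility as Unsigned
open import Data.Integer.Tactic.RingSolver using (solve-∀)
open import Algebra.Bundles using (CommutativeRing)
import Algebra.Solver.Ring
open import Algebra.Solver.Ring.AlmostCommutativeRing
  using (fromCommutativeRing; _-Raw-AlmostCommutative⟶_)
open import Relation.Binary.Bundles using (Setoid)
open import Relation.Binary.PropositionalEquality
import Relation.Binary.Reasoning.Setoid as SetoidReasoning
open import Relation.Nullary using (¬_; yes; no; contradiction)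
open import Relation.Nullary.Decidable using (from-yes; _×-dec_; ¬?)
open import Relation.Unary using (Decidable)

-- The ring ℤ⟦q⟧ of formal power series

infix  4 _≈_
infixl 6 _+ₛ_ _-ₛ_
infix  8 -ₛ_
infixr 7 _·_

_≈_ : Series → Series → Set
f ≈ g = ∀ n → f n ≡ g n

0ₛ : Series
0ₛ _ = + 0

_+ₛ_ : Series → Series → Series
(f +ₛ g) n = f n + g n

-ₛ_ : Series → Series
(-ₛ f) n = - f n

_-ₛ_ : Series → Series → Series
f -ₛ g = f +ₛ -ₛ g

_·_ : ℤ → Series → Series
(c · f) n = c * f n

tail : Series → Series
tail f n = f (suc n)

⊛-head : ∀ f g → (f ⊛ g) 0 ≡ f 0 * g 0
⊛-head f g = ℤ.+-identityʳ _

⊛-tail : ∀ f g n → (f ⊛ g) (suc n) ≡ f 0 * g (suc n) + (tail f ⊛ g) n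
⊛-tail f g n = cong (λ s → f 0 * g (suc n) + s) (cong sumℤ
  (trans (map-applyUpTo suc (λ i → f i * g (suc n ∸ i)) (suc n))
         (sym (map-applyUpTo id (λ i → tail f i * g (n ∸ i)) (suc n)))))

⊛-cong : ∀ {f f′ g g′} → f ≈ f′ → g ≈ g′ → f ⊛ g ≈ f′ ⊛ g′
⊛-cong {f} {f′} {g} {g′} f≈f′ g≈g′ zero = begin
  (f ⊛ g) 0     ≡⟨ ⊛-head f g ⟩
  f 0 * g 0     ≡⟨ cong₂ _*_ (f≈f′ 0) (g≈g′ 0) ⟩
  f′ 0 * g′ 0   ≡⟨ ⊛-head f′ g′ ⟨
  (f′ ⊛ g′) 0   ∎
  where open ≡-Reasoning
⊛-cong {f} {f′} {g} {g′} f≈f′ g≈g′ (suc n) = begin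
  (f ⊛ g) (suc n)                                 ≡⟨ ⊛-tail f g n ⟩
  f 0 * g (suc n) + (tail f ⊛ g) n                ≡⟨ cong₂ _+_ (cong₂ _*_ (f≈f′ 0) (g≈g′ (suc n)))
                                                             (⊛-cong (λ k → f≈f′ (suc k)) g≈g′ n) ⟩
  f′ 0 * g′ (suc n) + (tail f′ ⊛ g′) n            ≡⟨ ⊛-tail f′ g′ n ⟨
  (f′ ⊛ g′) (suc n)                               ∎
  where open ≡-Reasoning

⊛-congˡ : ∀ f {g g′} → g ≈ g′ → f ⊛ g ≈ f ⊛ g′
⊛-congˡ f = ⊛-cong {f} {f} (λ _ → refl)

⊛-congʳ : ∀ h {f f′} → f ≈ f′ → f ⊛ h ≈ f′ ⊛ h
⊛-congʳ h f≈f′ = ⊛-cong {g = h} {g′ = h} f≈f′ (λ _ → refl)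

+ₛ-cong : ∀ {f f′ g g′} → f ≈ f′ → g ≈ g′ → f +ₛ g ≈ f′ +ₛ g′
+ₛ-cong f≈f′ g≈g′ n = cong₂ _+_ (f≈f′ n) (g≈g′ n)

⊛-zeroˡ : ∀ g → 0ₛ ⊛ g ≈ 0ₛ
⊛-zeroˡ g zero    = ⊛-head 0ₛ g
⊛-zeroˡ g (suc n) = trans (⊛-tail 0ₛ g n) (cong (λ s → + 0 * g (suc n) + s) (⊛-zeroˡ g n))

⊛-identityˡ : ∀ g → one ⊛ g ≈ g
⊛-identityˡ g zero    = trans (⊛-head one g) (ℤ.*-identityˡ (g 0))
⊛-identityˡ g (suc n) = begin
  (one ⊛ g) (suc n)            ≡⟨ ⊛-tail one g n ⟩
  + 1 * g (suc n) + (0ₛ ⊛ g) n  ≡⟨ cong₂ _+_ (ℤ.*-identityˡ (g (suc n))) (⊛-zeroˡ g n) ⟩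
  g (suc n) + + 0               ≡⟨ ℤ.+-identityʳ (g (suc n)) ⟩
  g (suc n)                     ∎
  where open ≡-Reasoning

⊛-distribʳ : ∀ f g h → (f +ₛ g) ⊛ h ≈ f ⊛ h +ₛ g ⊛ h
⊛-distribʳ f g h zero = begin
  ((f +ₛ g) ⊛ h) 0              ≡⟨ ⊛-head (f +ₛ g) h ⟩
  (f 0 + g 0) * h 0             ≡⟨ ℤ.*-distribʳ-+ (h 0) (f 0) (g 0) ⟩
  f 0 * h 0 + g 0 * h 0         ≡⟨ cong₂ _+_ (⊛-head f h) (⊛-head g h) ⟨
  (f ⊛ h) 0 + (g ⊛ h) 0         ∎
  where open ≡-Reasoning
⊛-distribʳ f g h (suc n) = begin
  ((f +ₛ g) ⊛ h) (suc n)
    ≡⟨ ⊛-tail (f +ₛ g) h n ⟩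
  (f 0 + g 0) * h (suc n) + ((tail f +ₛ tail g) ⊛ h) n
    ≡⟨ cong (λ s → (f 0 + g 0) * h (suc n) + s) (⊛-distribʳ (tail f) (tail g) h n) ⟩
  (f 0 + g 0) * h (suc n) + ((tail f ⊛ h) n + (tail g ⊛ h) n)
    ≡⟨ regroup (f 0) (g 0) (h (suc n)) _ _ ⟩
  (f 0 * h (suc n) + (tail f ⊛ h) n) + (g 0 * h (suc n) + (tail g ⊛ h) n)
    ≡⟨ cong₂ _+_ (⊛-tail f h n) (⊛-tail g h n) ⟨
  (f ⊛ h) (suc n) + (g ⊛ h) (suc n)
    ∎
  where
  open ≡-Reasoning
  regroup : ∀ a b c x y → (a + b) * c + (x + y) ≡ (a * c + x) + (b * c + y)
  regroup = solve-∀

⊛-scaleˡ : ∀ c f g → (c · f) ⊛ g ≈ c · (f ⊛ g)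
⊛-scaleˡ c f g zero = begin
  ((c · f) ⊛ g) 0    ≡⟨ ⊛-head (c · f) g ⟩
  c * f 0 * g 0      ≡⟨ ℤ.*-assoc c (f 0) (g 0) ⟩
  c * (f 0 * g 0)    ≡⟨ cong (c *_) (⊛-head f g) ⟨
  c * (f ⊛ g) 0      ∎
  where open ≡-Reasoning
⊛-scaleˡ c f g (suc n) = begin
  ((c · f) ⊛ g) (suc n)                          ≡⟨ ⊛-tail (c · f) g n ⟩
  c * f 0 * g (suc n) + ((c · tail f) ⊛ g) n     ≡⟨ cong (λ s → c * f 0 * g (suc n) + s) (⊛-scaleˡ c (tail f) g n) ⟩
  c * f 0 * g (suc n) + c * (tail f ⊛ g) n       ≡⟨ factor c (f 0) (g (suc n)) _ ⟩
  c * (f 0 * g (suc n) + (tail f ⊛ g) n)         ≡⟨ cong (c *_) (⊛-tail f g n) ⟨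
  c * (f ⊛ g) (suc n)                            ∎
  where
  open ≡-Reasoning
  factor : ∀ c a b x → c * a * b + c * x ≡ c * (a * b + x)
  factor = solve-∀

⊛-init : ∀ f g n → (f ⊛ g) (suc n) ≡ (f ⊛ tail g) n + f (suc n) * g 0
⊛-init f g zero = begin
  (f ⊛ g) 1                        ≡⟨ ⊛-tail f g 0 ⟩
  f 0 * g 1 + (tail f ⊛ g) 0       ≡⟨ cong₂ _+_ (sym (⊛-head f (tail g))) (⊛-head (tail f) g) ⟩
  (f ⊛ tail g) 0 + f 1 * g 0       ∎
  where open ≡-Reasoning
⊛-init f g (suc n) = begin
  (f ⊛ g) (suc (suc n))
    ≡⟨ ⊛-tail f g (suc n) ⟩
  f 0 * g (suc (suc n)) + (tail f ⊛ g) (suc n)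
    ≡⟨ cong (λ s → f 0 * g (suc (suc n)) + s) (⊛-init (tail f) g n) ⟩
  f 0 * g (suc (suc n)) + ((tail f ⊛ tail g) n + f (suc (suc n)) * g 0)
    ≡⟨ ℤ.+-assoc (f 0 * g (suc (suc n))) _ _ ⟨
  f 0 * g (suc (suc n)) + (tail f ⊛ tail g) n + f (suc (suc n)) * g 0
    ≡⟨ cong (_+ f (suc (suc n)) * g 0) (⊛-tail f (tail g) n) ⟨
  (f ⊛ tail g) (suc n) + f (suc (suc n)) * g 0
    ∎
  where open ≡-Reasoning

⊛-comm : ∀ f g → f ⊛ g ≈ g ⊛ f
⊛-comm f g zero = trans (⊛-head f g) (trans (ℤ.*-comm (f 0) (g 0)) (sym (⊛-head g f)))
⊛-comm f g (suc n) = begin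
  (f ⊛ g) (suc n)                       ≡⟨ ⊛-tail f g n ⟩
  f 0 * g (suc n) + (tail f ⊛ g) n      ≡⟨ cong₂ _+_ (ℤ.*-comm (f 0) (g (suc n))) (⊛-comm (tail f) g n) ⟩
  g (suc n) * f 0 + (g ⊛ tail f) n      ≡⟨ ℤ.+-comm (g (suc n) * f 0) _ ⟩
  (g ⊛ tail f) n + g (suc n) * f 0      ≡⟨ ⊛-init g f n ⟨
  (g ⊛ f) (suc n)                       ∎
  where open ≡-Reasoning

⊛-assoc : ∀ f g h → (f ⊛ g) ⊛ h ≈ f ⊛ (g ⊛ h)
⊛-assoc f g h zero = begin
  ((f ⊛ g) ⊛ h) 0        ≡⟨ ⊛-head (f ⊛ g) h ⟩
  (f ⊛ g) 0 * h 0        ≡⟨ cong (_* h 0) (⊛-head f g) ⟩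
  f 0 * g 0 * h 0        ≡⟨ ℤ.*-assoc (f 0) (g 0) (h 0) ⟩
  f 0 * (g 0 * h 0)      ≡⟨ cong (f 0 *_) (⊛-head g h) ⟨
  f 0 * (g ⊛ h) 0        ≡⟨ ⊛-head f (g ⊛ h) ⟨
  (f ⊛ (g ⊛ h)) 0        ∎
  where open ≡-Reasoning
⊛-assoc f g h (suc n) = begin
  ((f ⊛ g) ⊛ h) (suc n)
    ≡⟨ ⊛-tail (f ⊛ g) h n ⟩
  (f ⊛ g) 0 * h (suc n) + (tail (f ⊛ g) ⊛ h) n
    ≡⟨ cong₂ _+_ (cong (_* h (suc n)) (⊛-head f g)) (⊛-congʳ h (⊛-tail f g) n) ⟩
  f 0 * g 0 * h (suc n) + ((f 0 · tail g +ₛ tail f ⊛ g) ⊛ h) n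
    ≡⟨ cong (λ s → f 0 * g 0 * h (suc n) + s) (⊛-distribʳ (f 0 · tail g) (tail f ⊛ g) h n) ⟩
  f 0 * g 0 * h (suc n) + (((f 0 · tail g) ⊛ h) n + ((tail f ⊛ g) ⊛ h) n)
    ≡⟨ cong (λ s → f 0 * g 0 * h (suc n) + s)
            (cong₂ _+_ (⊛-scaleˡ (f 0) (tail g) h n) (⊛-assoc (tail f) g h n)) ⟩
  f 0 * g 0 * h (suc n) + (f 0 * (tail g ⊛ h) n + (tail f ⊛ (g ⊛ h)) n)
    ≡⟨ regroup (f 0) (g 0) (h (suc n)) _ _ ⟩
  f 0 * (g 0 * h (suc n) + (tail g ⊛ h) n) + (tail f ⊛ (g ⊛ h)) n
    ≡⟨ cong (λ s → f 0 * s + (tail f ⊛ (g ⊛ h)) n) (⊛-tail g h n) ⟨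
  f 0 * (g ⊛ h) (suc n) + (tail f ⊛ (g ⊛ h)) n
    ≡⟨ ⊛-tail f (g ⊛ h) n ⟨
  (f ⊛ (g ⊛ h)) (suc n)
    ∎
  where
  open ≡-Reasoning
  regroup : ∀ a b c x y → a * b * c + (a * x + y) ≡ a * (b * c + x) + y
  regroup = solve-∀

⊛-identityʳ : ∀ f → f ⊛ one ≈ f
⊛-identityʳ f n = trans (⊛-comm f one n) (⊛-identityˡ f n)

⊛-distribˡ : ∀ f g h → f ⊛ (g +ₛ h) ≈ f ⊛ g +ₛ f ⊛ h
⊛-distribˡ f g h n = trans (⊛-comm f (g +ₛ h) n)
  (trans (⊛-distribʳ g h f n) (cong₂ _+_ (⊛-comm g f n) (⊛-comm h f n)))

ℤ⟦q⟧ : CommutativeRing 0ℓ 0ℓ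
ℤ⟦q⟧ = record
  { Carrier = Series ; _≈_ = _≈_ ; _+_ = _+ₛ_ ; _*_ = _⊛_ ; -_ = -ₛ_ ; 0# = 0ₛ ; 1# = one
  ; isCommutativeRing = record
    { isRing = record
      { +-isAbelianGroup = record
        { isGroup = record
          { isMonoid = record
            { isSemigroup = record
              { isMagma = record
                { isEquivalence = record
                  { refl = λ _ → refl ; sym = λ e n → sym (e n) ; trans = λ e e′ n → trans (e n) (e′ n) }
                ; ∙-cong = λ e e′ n → cong₂ _+_ (e n) (e′ n) }
              ; assoc = λ f g h n → ℤ.+-assoc (f n) (g n) (h n) }
            ; identity = (λ f n → ℤ.+-identityˡ (f n)) , (λ f n → ℤ.+-identityʳ (f n)) }
          ; inverse = (λ f n → ℤ.+-inverseˡ (f n)) , (λ f n → ℤ.+-inverseʳ (f n))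
          ; ⁻¹-cong = λ e n → cong -_ (e n) }
        ; comm = λ f g n → ℤ.+-comm (f n) (g n) }
      ; *-cong = ⊛-cong
      ; *-assoc = ⊛-assoc
      ; *-identity = ⊛-identityˡ , ⊛-identityʳ
      ; distrib = ⊛-distribˡ , λ h f g → ⊛-distribʳ f g h }
    ; *-comm = ⊛-comm } }

monomial : ℕ → ℤ → Series
monomial zero    c zero    = c
monomial zero    c (suc n) = + 0
monomial (suc i) c zero    = + 0
monomial (suc i) c (suc n) = monomial i c n

q^_ : ℕ → Series
q^ i = monomial i (+ 1)

monomial-≢ : ∀ i c {n} → n ≢ i → monomial i c n ≡ + 0
monomial-≢ zero    c {zero}  n≢i = contradiction refl n≢i
monomial-≢ zero    c {suc n} n≢i = refl
monomial-≢ (suc i) c {zero}  n≢i = refl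
monomial-≢ (suc i) c {suc n} n≢i = monomial-≢ i c (n≢i ∘ cong suc)

·-monomial : ∀ a i c → a · monomial i c ≈ monomial i (a * c)
·-monomial a zero    c zero    = refl
·-monomial a zero    c (suc n) = ℤ.*-zeroʳ a
·-monomial a (suc i) c zero    = ℤ.*-zeroʳ a
·-monomial a (suc i) c (suc n) = ·-monomial a i c n

-ₛ-monomial : ∀ i c → -ₛ monomial i c ≈ monomial i (- c)
-ₛ-monomial zero    c zero    = refl
-ₛ-monomial zero    c (suc n) = refl
-ₛ-monomial (suc i) c zero    = refl
-ₛ-monomial (suc i) c (suc n) = -ₛ-monomial i c n

monomial₀-⊛ : ∀ c g → monomial 0 c ⊛ g ≈ c · g
monomial₀-⊛ c g zero    = ⊛-head (monomial 0 c) g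
monomial₀-⊛ c g (suc n) = begin
  (monomial 0 c ⊛ g) (suc n)        ≡⟨ ⊛-tail (monomial 0 c) g n ⟩
  c * g (suc n) + (0ₛ ⊛ g) n        ≡⟨ cong (λ s → c * g (suc n) + s) (⊛-zeroˡ g n) ⟩
  c * g (suc n) + + 0               ≡⟨ ℤ.+-identityʳ (c * g (suc n)) ⟩
  c * g (suc n)                     ∎
  where open ≡-Reasoning

monomial-suc-⊛-head : ∀ i c g → (monomial (suc i) c ⊛ g) 0 ≡ + 0
monomial-suc-⊛-head i c g = trans (⊛-head (monomial (suc i) c) g) (ℤ.*-zeroˡ (g 0))

monomial-suc-⊛-tail : ∀ i c g n → (monomial (suc i) c ⊛ g) (suc n) ≡ (monomial i c ⊛ g) n
monomial-suc-⊛-tail i c g n = begin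
  (monomial (suc i) c ⊛ g) (suc n)          ≡⟨ ⊛-tail (monomial (suc i) c) g n ⟩
  + 0 * g (suc n) + (monomial i c ⊛ g) n    ≡⟨ cong (_+ (monomial i c ⊛ g) n) (ℤ.*-zeroˡ (g (suc n))) ⟩
  + 0 + (monomial i c ⊛ g) n                ≡⟨ ℤ.+-identityˡ _ ⟩
  (monomial i c ⊛ g) n                      ∎
  where open ≡-Reasoning

monomial-⊛-below : ∀ i c g {n} → n < i → (monomial i c ⊛ g) n ≡ + 0
monomial-⊛-below (suc i) c g {zero}  _         = monomial-suc-⊛-head i c g
monomial-⊛-below (suc i) c g {suc n} (s≤s n<i) =
  trans (monomial-suc-⊛-tail i c g n) (monomial-⊛-below i c g n<i)

monomial-⊛-shift : ∀ i c g n → (monomial i c ⊛ g) (i ℕ.+ n) ≡ c * g n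
monomial-⊛-shift zero    c g n = monomial₀-⊛ c g n
monomial-⊛-shift (suc i) c g n = trans (monomial-suc-⊛-tail i c g (i ℕ.+ n)) (monomial-⊛-shift i c g n)

monomial-⊛ : ∀ i a j b → monomial i a ⊛ monomial j b ≈ monomial (i ℕ.+ j) (a * b)
monomial-⊛ zero    a j b n       = trans (monomial₀-⊛ a (monomial j b) n) (·-monomial a j b n)
monomial-⊛ (suc i) a j b zero    = monomial-suc-⊛-head i a (monomial j b)
monomial-⊛ (suc i) a j b (suc n) = trans (monomial-suc-⊛-tail i a (monomial j b) n) (monomial-⊛ i a j b n)

q^-⊛-monomial : ∀ i j c → q^ i ⊛ monomial j c ≈ monomial (i ℕ.+ j) c
q^-⊛-monomial i j c n = trans (monomial-⊛ i (+ 1) j c n) (cong (λ a → monomial (i ℕ.+ j) a n) (ℤ.*-identityˡ c))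

q^-+ : ∀ i j → q^ (i ℕ.+ j) ≈ q^ i ⊛ q^ j
q^-+ i j n = sym (q^-⊛-monomial i j (+ 1) n)

pow-monomial : ∀ i c k → pow (monomial i c) k ≈ monomial (k ℕ.* i) (c ^ k)
pow-monomial i c zero    zero    = refl
pow-monomial i c zero    (suc n) = refl
pow-monomial i c (suc k) n       =
  trans (⊛-congˡ (monomial i c) (pow-monomial i c k) n) (monomial-⊛ i c (k ℕ.* i) (c ^ k) n)

constant-homomorphism : ℤ.+-*-rawRing -Raw-AlmostCommutative⟶ fromCommutativeRing ℤ⟦q⟧
constant-homomorphism = record
  { ⟦_⟧    = monomial 0
  ; +-homo = λ { a b zero → refl ; a b (suc n) → refl }
  ; *-homo = λ a b n → sym (monomial-⊛ 0 a 0 b n)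
  ; -‿homo = λ { a zero → refl ; a (suc n) → refl }
  ; 0-homo = λ { zero → refl ; (suc n) → refl }
  ; 1-homo = λ { zero → refl ; (suc n) → refl }
  }

constant-≟ : ∀ a b → Maybe (monomial 0 a ≈ monomial 0 b)
constant-≟ a b with a ℤ.≟ b
... | yes refl = just λ _ → refl
... | no _     = nothing

module SeriesSolver =
  Algebra.Solver.Ring ℤ.+-*-rawRing (fromCommutativeRing ℤ⟦q⟧) constant-homomorphism constant-≟

pow-cong : ∀ {f g} k → f ≈ g → pow f k ≈ pow g k
pow-cong zero    f≈g n = refl
pow-cong (suc k) f≈g   = ⊛-cong f≈g (pow-cong k f≈g)

pow-+ : ∀ f a b → pow f (a ℕ.+ b) ≈ pow f a ⊛ pow f b
pow-+ f zero    b n = sym (⊛-identityˡ (pow f b) n)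
pow-+ f (suc a) b n = trans (⊛-congˡ f (pow-+ f a b) n) (sym (⊛-assoc f (pow f a) (pow f b) n))

pow-* : ∀ f a b → pow f (b ℕ.* a) ≈ pow (pow f a) b
pow-* f a zero    n = refl
pow-* f a (suc b) n = trans (pow-+ f a (b ℕ.* a) n) (⊛-congˡ (pow f a) (pow-* f a b) n)

pow-suc-* : ∀ f d k → pow f (suc (d ℕ.* k)) ≈ pow (pow f d) k ⊛ f
pow-suc-* f d k = begin
  f ⊛ pow f (d ℕ.* k)          ≈⟨ ⊛-comm f (pow f (d ℕ.* k)) ⟩
  pow f (d ℕ.* k) ⊛ f          ≡⟨ cong (λ e → pow f e ⊛ f) (ℕ.*-comm d k) ⟩
  pow f (k ℕ.* d) ⊛ f          ≈⟨ ⊛-congʳ f (pow-* f d k) ⟩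
  pow (pow f d) k ⊛ f          ∎
  where open SetoidReasoning (CommutativeRing.setoid ℤ⟦q⟧)

pow-*-pred : ∀ f g d e j → suc e ≡ d → f ⊛ g ≈ one → pow f (d ℕ.* j ℕ.+ e) ≈ pow (pow f d) (suc j) ⊛ g
pow-*-pred f g .(suc e) e j refl f⊛g≈1 = begin
  pow f m                      ≈⟨ ⊛-identityʳ (pow f m) ⟨
  pow f m ⊛ one                ≈⟨ ⊛-congˡ (pow f m) f⊛g≈1 ⟨
  pow f m ⊛ (f ⊛ g)            ≈⟨ ⊛-assoc (pow f m) f g ⟨
  pow f m ⊛ f ⊛ g              ≈⟨ ⊛-congʳ g (⊛-comm (pow f m) f) ⟩
  pow f (suc m) ⊛ g            ≡⟨ cong (λ i → pow f i ⊛ g) (exponent e j) ⟩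
  pow f (suc j ℕ.* suc e) ⊛ g  ≈⟨ ⊛-congʳ g (pow-* f (suc e) (suc j)) ⟩
  pow (pow f (suc e)) (suc j) ⊛ g ∎
  where
  open SetoidReasoning (CommutativeRing.setoid ℤ⟦q⟧)
  m = suc e ℕ.* j ℕ.+ e
  exponent : ∀ e j → suc (suc e ℕ.* j ℕ.+ e) ≡ suc j ℕ.* suc e
  exponent = ℕ-solve-∀

invRev-dot : ∀ f g n → sumℤ (zipWith _*_ (applyUpTo g (suc n)) (invRev f n)) ≡ (g ⊛ inv f) n
invRev-dot f g zero    = trans (ℤ.+-identityʳ (g 0 * + 1)) (sym (⊛-head g (inv f)))
invRev-dot f g (suc n) =
  trans (cong (λ s → g 0 * inv f (suc n) + s) (invRev-dot f (tail g) n)) (sym (⊛-tail g (inv f) n))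

inv-tail : ∀ f n → inv f (suc n) ≡ - (tail f ⊛ inv f) n
inv-tail f n = cong -_ (trans (cong (λ fs → sumℤ (zipWith _*_ fs (invRev f n))) (map-applyUpTo id (tail f) (suc n)))
                              (invRev-dot f (tail f) n))

⊛-inv : ∀ f → f 0 ≡ + 1 → f ⊛ inv f ≈ one
⊛-inv f f0≡1 zero    = trans (⊛-head f (inv f)) (cong (_* + 1) f0≡1)
⊛-inv f f0≡1 (suc n) = begin
  (f ⊛ inv f) (suc n)               ≡⟨ ⊛-tail f (inv f) n ⟩
  f 0 * inv f (suc n) + t           ≡⟨ cong₂ (λ a b → a * b + t) f0≡1 (inv-tail f n) ⟩
  + 1 * - t + t                     ≡⟨ cong (_+ t) (ℤ.*-identityˡ (- t)) ⟩
  - t + t                           ≡⟨ ℤ.+-inverseˡ t ⟩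
  + 0                               ∎
  where
  open ≡-Reasoning
  t = (tail f ⊛ inv f) n

-- Congruences of power series

∣0 : ∀ m → m ∣ + 0
∣0 m = divides (+ 0) refl

infix 4 _∣ˢ_ _≈_[mod_]

_∣ˢ_ : ℤ → Series → Set
m ∣ˢ f = ∀ n → m ∣ f n

-- A record rather than a function type, so that f and g can be inferred from it.
record _≈_[mod_] (f g : Series) (m : ℤ) : Set where
  constructor coeffwise
  field ∣-difference : m ∣ˢ f -ₛ g

open _≈_[mod_]

≈⇒≈[mod] : ∀ {f g} m → f ≈ g → f ≈ g [mod m ]
≈⇒≈[mod] {f} m f≈g = coeffwise λ n →
  subst (λ x → m ∣ f n - x) (f≈g n) (subst (m ∣_) (sym (ℤ.+-inverseʳ (f n))) (∣0 m))

≈[mod]-sym : ∀ {f g m} → f ≈ g [mod m ] → g ≈ f [mod m ]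
≈[mod]-sym {f} {g} {m} f≈g = coeffwise λ n →
  subst (m ∣_) (negate-difference (f n) (g n)) (∣m⇒∣-m (∣-difference f≈g n))
  where
  negate-difference : ∀ a b → - (a - b) ≡ b - a
  negate-difference = solve-∀

≈[mod]-trans : ∀ {f g h m} → f ≈ g [mod m ] → g ≈ h [mod m ] → f ≈ h [mod m ]
≈[mod]-trans {f} {g} {h} {m} f≈g g≈h = coeffwise λ n →
  subst (m ∣_) (ℤ.+-minus-telescope (f n) (g n) (h n))
    (∣m∣n⇒∣m+n (∣-difference f≈g n) (∣-difference g≈h n))

≈[mod]-setoid : ℤ → Setoid 0ℓ 0ℓ
≈[mod]-setoid m = record
  { Carrier       = Series
  ; _≈_           = _≈_[mod m ]
  ; isEquivalence = record
    { refl  = ≈⇒≈[mod] m (λ _ → refl)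
    ; sym   = ≈[mod]-sym
    ; trans = ≈[mod]-trans
    }
  }

⊛-∣-termwise : ∀ m f g n → (∀ i j → i ℕ.+ j ≡ n → m ∣ f i * g j) → m ∣ (f ⊛ g) n
⊛-∣-termwise m f g zero    terms = subst (m ∣_) (sym (⊛-head f g)) (terms 0 0 refl)
⊛-∣-termwise m f g (suc n) terms = subst (m ∣_) (sym (⊛-tail f g n))
  (∣m∣n⇒∣m+n (terms 0 (suc n) refl)
              (⊛-∣-termwise m (tail f) g n λ i j i+j≡n → terms (suc i) j (cong suc i+j≡n)))

∣ˢ-⊛ : ∀ {m f} g → m ∣ˢ f → m ∣ˢ f ⊛ g
∣ˢ-⊛ {m} {f} g m∣f n = ⊛-∣-termwise m f g n λ i j _ → ∣m⇒∣m*n (g j) (m∣f i)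

≈[mod]-⊛-congʳ : ∀ {m f f′} h → f ≈ f′ [mod m ] → f ⊛ h ≈ f′ ⊛ h [mod m ]
≈[mod]-⊛-congʳ {m} {f} {f′} h f≈f′ = coeffwise λ n →
  subst (m ∣_) (distrib n) (∣ˢ-⊛ h (∣-difference f≈f′) n)
  where
  open SeriesSolver
  distrib : (f -ₛ f′) ⊛ h ≈ f ⊛ h -ₛ f′ ⊛ h
  distrib = solve 3 (λ f f′ h → (f :- f′) :* h := f :* h :- f′ :* h) (λ _ → refl) f f′ h

≈[mod]-⊛-cong : ∀ {m f f′ g g′} → f ≈ f′ [mod m ] → g ≈ g′ [mod m ] → f ⊛ g ≈ f′ ⊛ g′ [mod m ]
≈[mod]-⊛-cong {m} {f} {f′} {g} {g′} f≈f′ g≈g′ = begin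
  f ⊛ g      ≈⟨ ≈[mod]-⊛-congʳ g f≈f′ ⟩
  f′ ⊛ g     ≈⟨ ≈⇒≈[mod] m (⊛-comm f′ g) ⟩
  g ⊛ f′     ≈⟨ ≈[mod]-⊛-congʳ f′ g≈g′ ⟩
  g′ ⊛ f′    ≈⟨ ≈⇒≈[mod] m (⊛-comm g′ f′) ⟩
  f′ ⊛ g′    ∎
  where open SetoidReasoning (≈[mod]-setoid m)

≈[mod]-pow-cong : ∀ {m f g} k → f ≈ g [mod m ] → pow f k ≈ pow g k [mod m ]
≈[mod]-pow-cong {m} zero    f≈g = ≈⇒≈[mod] m (λ _ → refl)
≈[mod]-pow-cong     (suc k) f≈g = ≈[mod]-⊛-cong f≈g (≈[mod]-pow-cong k f≈g)

+ₛ-multiple : ∀ m f h → f +ₛ monomial 0 m ⊛ h ≈ f [mod m ]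
+ₛ-multiple m f h = coeffwise λ n → subst (m ∣_) (sym (cancel (f n) n)) (∣m⇒∣m*n (h n) ∣-refl)
  where
  cancel : ∀ a n → a + (monomial 0 m ⊛ h) n - a ≡ m * h n
  cancel a n = trans (cong (λ x → a + x - a) (monomial₀-⊛ m h n)) (lemma a (m * h n))
    where
    lemma : ∀ a x → a + x - a ≡ x
    lemma = solve-∀

-- The Frobenius congruence modulo 5

fermat₅-ℕ : ∀ n → + 5 ∣ (+ n) ^ 5 - + n
fermat₅-ℕ zero    = ∣0 (+ 5)
fermat₅-ℕ (suc n) = subst (+ 5 ∣_) (sym (binomial (+ n)))
  (∣m∣n⇒∣m+n (fermat₅-ℕ n) (∣m⇒∣m*n _ ∣-refl))
  where
  binomial : ∀ c → let d = + 1 + c in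
    d * (d * (d * (d * (d * + 1)))) - d
      ≡ (c * (c * (c * (c * (c * + 1)))) - c) + + 5 * (c * c * c * c + + 2 * c * c * c + + 2 * c * c + c)
  binomial = solve-∀

fermat₅ : ∀ c → + 5 ∣ c ^ 5 - c
fermat₅ (+ n)      = fermat₅-ℕ n
fermat₅ -[1+ n ]   = subst (+ 5 ∣_) (odd (+ suc n)) (∣m⇒∣-m (fermat₅-ℕ (suc n)))
  where
  odd : ∀ c → let d = - c in
    - (c * (c * (c * (c * (c * + 1)))) - c) ≡ d * (d * (d * (d * (d * + 1)))) - d
  odd = solve-∀

freshman₅ : ∀ a b → pow (a +ₛ b) 5 ≈ pow a 5 +ₛ pow b 5 [mod + 5 ]
freshman₅ a b =
  ≈[mod]-trans (≈⇒≈[mod] (+ 5) (binomial a b)) (+ₛ-multiple (+ 5) (pow a 5 +ₛ pow b 5) (middle a b))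
  where
  open SeriesSolver
  middle : Series → Series → Series
  middle a b = pow a 4 ⊛ b +ₛ monomial 0 (+ 2) ⊛ pow a 3 ⊛ pow b 2
               +ₛ monomial 0 (+ 2) ⊛ pow a 2 ⊛ pow b 3 +ₛ a ⊛ pow b 4
  binomial : ∀ a b → pow (a +ₛ b) 5 ≈ pow a 5 +ₛ pow b 5 +ₛ monomial 0 (+ 5) ⊛ middle a b
  binomial = solve 2 (λ a b → (a :+ b) :^ 5
    := a :^ 5 :+ b :^ 5 :+ con (+ 5) :* (a :^ 4 :* b :+ con (+ 2) :* a :^ 3 :* b :^ 2
                                          :+ con (+ 2) :* a :^ 2 :* b :^ 3 :+ a :* b :^ 4)) (λ _ → refl)

dilate₅ : Series → Series
dilate₅ f zero                            = f 0
dilate₅ f (suc zero)                      = + 0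
dilate₅ f (suc (suc zero))                = + 0
dilate₅ f (suc (suc (suc zero)))          = + 0
dilate₅ f (suc (suc (suc (suc zero))))    = + 0
dilate₅ f (suc (suc (suc (suc (suc n))))) = dilate₅ (tail f) n

head-tail : ∀ f → f ≈ monomial 0 (f 0) +ₛ q^ 1 ⊛ tail f
head-tail f zero = sym (trans (cong (λ x → f 0 + x) (monomial-suc-⊛-head 0 (+ 1) (tail f))) (ℤ.+-identityʳ (f 0)))
head-tail f (suc n) = sym (begin
  + 0 + (q^ 1 ⊛ tail f) (suc n)   ≡⟨ ℤ.+-identityˡ _ ⟩
  (q^ 1 ⊛ tail f) (suc n)         ≡⟨ monomial-⊛-shift 1 (+ 1) (tail f) n ⟩
  + 1 * f (suc n)                 ≡⟨ ℤ.*-identityˡ (f (suc n)) ⟩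
  f (suc n)                       ∎)
  where open ≡-Reasoning

pow⁵-head-tail : ∀ f → pow f 5 ≈ monomial 0 (f 0 ^ 5) +ₛ q^ 5 ⊛ pow (tail f) 5 [mod + 5 ]
pow⁵-head-tail f = begin
  pow f 5                                         ≈⟨ ≈⇒≈[mod] (+ 5) (pow-cong 5 (head-tail f)) ⟩
  pow (monomial 0 (f 0) +ₛ q^ 1 ⊛ tail f) 5       ≈⟨ freshman₅ (monomial 0 (f 0)) (q^ 1 ⊛ tail f) ⟩
  pow (monomial 0 (f 0)) 5 +ₛ pow (q^ 1 ⊛ tail f) 5
    ≈⟨ ≈⇒≈[mod] (+ 5) (+ₛ-cong (pow-monomial 0 (f 0) 5) power-of-product) ⟩
  monomial 0 (f 0 ^ 5) +ₛ q^ 5 ⊛ pow (tail f) 5   ∎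
  where
  open SetoidReasoning (≈[mod]-setoid (+ 5))
  open SeriesSolver
  power-of-product : pow (q^ 1 ⊛ tail f) 5 ≈ q^ 5 ⊛ pow (tail f) 5
  power-of-product n =
    trans (solve 2 (λ x g → (x :* g) :^ 5 := x :^ 5 :* g :^ 5) (λ _ → refl) (q^ 1) (tail f) n)
          (⊛-congʳ (pow (tail f) 5) (pow-monomial 1 (+ 1) 5) n)

-- By pow⁵-head-tail, coefficient n + 5 of f⁵ is coefficient n of (tail f)⁵ modulo 5, just as for f(q⁵).
frobenius-coefficient : ∀ f n → + 5 ∣ pow f 5 n - dilate₅ f n
frobenius-coefficient f n = subst (+ 5 ∣_) (ℤ.+-minus-telescope (pow f 5 n) _ (dilate₅ f n))
  (∣m∣n⇒∣m+n (∣-difference (pow⁵-head-tail f) n) (compare n))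
  where
  c = f 0
  g = tail f
  rest = q^ 5 ⊛ pow g 5

  rest-below : ∀ {k} → k < 5 → rest k ≡ + 0
  rest-below = monomial-⊛-below 5 (+ 1) (pow g 5)

  rest-shift : ∀ k → rest (5 ℕ.+ k) ≡ pow g 5 k
  rest-shift k = trans (monomial-⊛-shift 5 (+ 1) (pow g 5) k) (ℤ.*-identityˡ (pow g 5 k))

  vanishing : ∀ k → suc k < 5 → + 5 ∣ + 0 + rest (suc k) - + 0
  vanishing k k<5 = subst (λ x → + 5 ∣ + 0 + x - + 0) (sym (rest-below k<5)) (∣0 (+ 5))

  compare : ∀ k → + 5 ∣ (monomial 0 (c ^ 5) +ₛ rest) k - dilate₅ f k
  compare zero = subst (λ x → + 5 ∣ x - c)
    (sym (trans (cong (λ x → c ^ 5 + x) (rest-below (s≤s z≤n))) (ℤ.+-identityʳ (c ^ 5)))) (fermat₅ c)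
  compare 1 = vanishing 0 (from-yes (1 ℕ.<? 5))
  compare 2 = vanishing 1 (from-yes (2 ℕ.<? 5))
  compare 3 = vanishing 2 (from-yes (3 ℕ.<? 5))
  compare 4 = vanishing 3 (from-yes (4 ℕ.<? 5))
  compare (suc (suc (suc (suc (suc k))))) = subst (λ x → + 5 ∣ x - dilate₅ g k)
    (sym (trans (ℤ.+-identityˡ _) (rest-shift k))) (frobenius-coefficient g k)

frobenius : ∀ f → pow f 5 ≈ dilate₅ f [mod + 5 ]
frobenius f = coeffwise (frobenius-coefficient f)

dilate₅-off : ∀ f {n} → 5 ∤ℕ n → dilate₅ f n ≡ + 0
dilate₅-off f {zero}                            5∤n = contradiction (ℕᵈ.divides 0 refl) 5∤n
dilate₅-off f {suc zero}                        5∤n = refl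
dilate₅-off f {suc (suc zero)}                  5∤n = refl
dilate₅-off f {suc (suc (suc zero))}            5∤n = refl
dilate₅-off f {suc (suc (suc (suc zero)))}      5∤n = refl
dilate₅-off f {suc (suc (suc (suc (suc n))))}   5∤n =
  dilate₅-off (tail f) (5∤n ∘ ℕᵈ.∣m∣n⇒∣m+n (ℕᵈ.∣-refl {5}))

dilate₅-multiple : ∀ f m → dilate₅ f (m ℕ.* 5) ≡ f m
dilate₅-multiple f zero    = refl
dilate₅-multiple f (suc m) = dilate₅-multiple (tail f) m

dilate₅²-off : ∀ f {n} → 25 ∤ℕ n → dilate₅ (dilate₅ f) n ≡ + 0
dilate₅²-off f {n} 25∤n with 5 ℕᵈ.∣? n
... | no 5∤n = dilate₅-off (dilate₅ f) 5∤n
... | yes (ℕᵈ.divides m refl) = trans (dilate₅-multiple (dilate₅ f) m) (dilate₅-off f 5∤m)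
  where
  5∤m : 5 ∤ℕ m
  5∤m (ℕᵈ.divides k refl) = 25∤n (ℕᵈ.divides k (ℕ.*-assoc k 5 5))

infix 4 _∈ℤ⟦q^_⟧[mod_]

_∈ℤ⟦q^_⟧[mod_] : Series → ℕ → ℤ → Set
f ∈ℤ⟦q^ d ⟧[mod m ] = ∀ n → d ∤ℕ n → m ∣ f n

one-∈ℤ⟦q^⟧ : ∀ {d} m → one ∈ℤ⟦q^ d ⟧[mod m ]
one-∈ℤ⟦q^⟧ m zero    d∤0 = contradiction (ℕᵈ.divides 0 refl) d∤0
one-∈ℤ⟦q^⟧ m (suc n) _   = ∣0 m

⊛-∈ℤ⟦q^⟧ : ∀ {d m} f g →
  f ∈ℤ⟦q^ d ⟧[mod m ] → g ∈ℤ⟦q^ d ⟧[mod m ] → f ⊛ g ∈ℤ⟦q^ d ⟧[mod m ]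
⊛-∈ℤ⟦q^⟧ {d} {m} f g f∈ g∈ n d∤n = ⊛-∣-termwise m f g n term
  where
  term : ∀ i j → i ℕ.+ j ≡ n → m ∣ f i * g j
  term i j i+j≡n with d ℕᵈ.∣? i | d ℕᵈ.∣? j
  ... | no d∤i | _       = ∣m⇒∣m*n (g j) (f∈ i d∤i)
  ... | yes _  | no d∤j  = ∣n⇒∣m*n (f i) (g∈ j d∤j)
  ... | yes d∣i | yes d∣j = contradiction (subst (d ∣ℕ_) i+j≡n (ℕᵈ.∣m∣n⇒∣m+n d∣i d∣j)) d∤n

pow-∈ℤ⟦q^⟧ : ∀ {d m} f k → f ∈ℤ⟦q^ d ⟧[mod m ] → pow f k ∈ℤ⟦q^ d ⟧[mod m ]
pow-∈ℤ⟦q^⟧ {m = m} f zero    f∈ = one-∈ℤ⟦q^⟧ m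
pow-∈ℤ⟦q^⟧         f (suc k) f∈ = ⊛-∈ℤ⟦q^⟧ f (pow f k) f∈ (pow-∈ℤ⟦q^⟧ f k f∈)

pow²⁵-≈-dilate₅² : ∀ f → pow f 25 ≈ dilate₅ (dilate₅ f) [mod + 5 ]
pow²⁵-≈-dilate₅² f = begin
  pow f 25                 ≈⟨ ≈⇒≈[mod] (+ 5) (pow-* f 5 5) ⟩
  pow (pow f 5) 5          ≈⟨ ≈[mod]-pow-cong 5 (frobenius f) ⟩
  pow (dilate₅ f) 5        ≈⟨ frobenius (dilate₅ f) ⟩
  dilate₅ (dilate₅ f)      ∎
  where open SetoidReasoning (≈[mod]-setoid (+ 5))

pow²⁵-∈ℤ⟦q²⁵⟧ : ∀ f → pow f 25 ∈ℤ⟦q^ 25 ⟧[mod + 5 ]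
pow²⁵-∈ℤ⟦q²⁵⟧ f n 25∤n = subst (+ 5 ∣_) (ℤ.+-identityʳ (pow f 25 n))
  (subst (λ x → + 5 ∣ pow f 25 n - x) (dilate₅²-off f 25∤n) (∣-difference (pow²⁵-≈-dilate₅² f) n))

-- Euler's pentagonal number theorem via Shanks' identity

-1^_ : ℕ → ℤ
-1^ zero  = + 1
-1^ suc k = - (-1^ k)

-- Written with q^ 0 rather than one, which the ring solver reads as the constant 1.
1-q^_ : ℕ → Series
1-q^ k = q^ 0 -ₛ q^ k

poch : ℕ → ℕ → Series
poch a zero    = one
poch a (suc l) = 1-q^ a ⊛ poch (suc a) l

poch-snoc : ∀ a l → poch a (suc l) ≈ poch a l ⊛ 1-q^ (a ℕ.+ l)
poch-snoc a zero = begin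
  1-q^ a ⊛ one        ≈⟨ ⊛-identityʳ (1-q^ a) ⟩
  1-q^ a              ≈⟨ ⊛-identityˡ (1-q^ a) ⟨
  one ⊛ 1-q^ a        ≡⟨ cong (λ i → one ⊛ 1-q^ i) (sym (ℕ.+-identityʳ a)) ⟩
  one ⊛ 1-q^ (a ℕ.+ 0) ∎
  where open SetoidReasoning (CommutativeRing.setoid ℤ⟦q⟧)
poch-snoc a (suc l) = begin
  1-q^ a ⊛ poch (suc a) (suc l)                     ≈⟨ ⊛-congˡ (1-q^ a) (poch-snoc (suc a) l) ⟩
  1-q^ a ⊛ (poch (suc a) l ⊛ 1-q^ (suc a ℕ.+ l))    ≈⟨ ⊛-assoc (1-q^ a) (poch (suc a) l) _ ⟨
  poch a (suc l) ⊛ 1-q^ (suc a ℕ.+ l)               ≡⟨ cong (λ i → poch a (suc l) ⊛ 1-q^ i) (sym (ℕ.+-suc a l)) ⟩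
  poch a (suc l) ⊛ 1-q^ (a ℕ.+ suc l)               ∎
  where open SetoidReasoning (CommutativeRing.setoid ℤ⟦q⟧)

oneMinusQ^≈1-q^ : ∀ k → oneMinusQ^ (suc k) ≈ 1-q^ (suc k)
oneMinusQ^≈1-q^ k zero    = refl
oneMinusQ^≈1-q^ k (suc n) = coefficient k n
  where
  coefficient : ∀ k n → (if suc n ℕ.≡ᵇ suc k then -[1+ 0 ] else + 0) ≡ + 0 + - monomial k (+ 1) n
  coefficient zero    zero    = refl
  coefficient zero    (suc n) = refl
  coefficient (suc k) zero    = refl
  coefficient (suc k) (suc n) = coefficient k n

qPochUpTo≈poch : ∀ n → qPochUpTo n ≈ poch 1 n
qPochUpTo≈poch zero    = λ _ → refl
qPochUpTo≈poch (suc n) k = trans (⊛-cong (qPochUpTo≈poch n) (oneMinusQ^≈1-q^ n) k) (sym (poch-snoc 1 n k))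

-- n k + k (k + 1) / 2
shanksExp : ℕ → ℕ → ℕ
shanksExp n zero    = 0
shanksExp n (suc k) = n ℕ.+ suc k ℕ.+ shanksExp n k

shanksExp-sucˡ : ∀ n k → shanksExp (suc n) k ≡ k ℕ.+ shanksExp n k
shanksExp-sucˡ n zero    = refl
shanksExp-sucˡ n (suc k) =
  trans (cong (λ e → suc n ℕ.+ suc k ℕ.+ e) (shanksExp-sucˡ n k)) (regroup n k (shanksExp n k))
  where
  regroup : ∀ n k e → suc n ℕ.+ suc k ℕ.+ (k ℕ.+ e) ≡ suc k ℕ.+ (n ℕ.+ suc k ℕ.+ e)
  regroup = ℕ-solve-∀

shanksExp-double : ∀ n k → 2 ℕ.* shanksExp n k ≡ k ℕ.* (2 ℕ.* n ℕ.+ suc k)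
shanksExp-double n zero    = refl
shanksExp-double n (suc k) = begin
  2 ℕ.* (n ℕ.+ suc k ℕ.+ shanksExp n k)                ≡⟨ distribute n k (shanksExp n k) ⟩
  2 ℕ.* (n ℕ.+ suc k) ℕ.+ 2 ℕ.* shanksExp n k          ≡⟨ cong (λ d → 2 ℕ.* (n ℕ.+ suc k) ℕ.+ d) (shanksExp-double n k) ⟩
  2 ℕ.* (n ℕ.+ suc k) ℕ.+ k ℕ.* (2 ℕ.* n ℕ.+ suc k)    ≡⟨ collect n k ⟩
  suc k ℕ.* (2 ℕ.* n ℕ.+ suc (suc k))                  ∎
  where
  open ≡-Reasoning
  distribute : ∀ n k e → 2 ℕ.* (n ℕ.+ suc k ℕ.+ e) ≡ 2 ℕ.* (n ℕ.+ suc k) ℕ.+ 2 ℕ.* e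
  distribute = ℕ-solve-∀
  collect : ∀ n k → 2 ℕ.* (n ℕ.+ suc k) ℕ.+ k ℕ.* (2 ℕ.* n ℕ.+ suc k) ≡ suc k ℕ.* (2 ℕ.* n ℕ.+ suc (suc k))
  collect = ℕ-solve-∀

shanksTerm : ℕ → ℕ → Series
shanksTerm n k = monomial (shanksExp n k) (-1^ k) ⊛ poch (suc k) (n ∸ k)

sumUpTo : ℕ → (ℕ → Series) → Series
sumUpTo zero    g = g 0
sumUpTo (suc j) g = sumUpTo j g +ₛ g (suc j)

shanksSum : ℕ → Series
shanksSum n = sumUpTo n (shanksTerm n)

shanksTerm-sucˡ : ∀ m k → k ≤ m → shanksTerm (suc m) k ≈ q^ k ⊛ (1-q^ (suc m) ⊛ shanksTerm m k)
shanksTerm-sucˡ m k k≤m = begin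
  shanksTerm (suc m) k
    ≡⟨ cong₂ (λ e l → monomial e s ⊛ poch (suc k) l) (shanksExp-sucˡ m k) (ℕ.+-∸-assoc 1 k≤m) ⟩
  monomial (k ℕ.+ e) s ⊛ poch (suc k) (suc l)
    ≈⟨ ⊛-cong (λ n → sym (q^-⊛-monomial k e s n)) (poch-snoc (suc k) l) ⟩
  (q^ k ⊛ monomial e s) ⊛ (poch (suc k) l ⊛ 1-q^ (suc k ℕ.+ l))
    ≡⟨ cong (λ i → (q^ k ⊛ monomial e s) ⊛ (poch (suc k) l ⊛ 1-q^ suc i)) (ℕ.m+[n∸m]≡n k≤m) ⟩
  (q^ k ⊛ monomial e s) ⊛ (poch (suc k) l ⊛ 1-q^ (suc m))
    ≈⟨ solve 4 (λ x t p u → (x :* t) :* (p :* u) := x :* (u :* (t :* p))) (λ _ → refl)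
               (q^ k) (monomial e s) (poch (suc k) l) (1-q^ (suc m)) ⟩
  q^ k ⊛ (1-q^ (suc m) ⊛ shanksTerm m k)
    ∎
  where
  open SetoidReasoning (CommutativeRing.setoid ℤ⟦q⟧)
  open SeriesSolver
  e = shanksExp m k
  s = -1^ k
  l = m ∸ k

1-q^-⊛-shanksTerm-suc : ∀ m k → suc k ≤ m →
  1-q^ (suc k) ⊛ shanksTerm m (suc k) ≈ -ₛ (q^ (m ℕ.+ suc k) ⊛ shanksTerm m k)
1-q^-⊛-shanksTerm-suc m k k<m = begin
  1-q^ (suc k) ⊛ (monomial (i ℕ.+ e) (- s) ⊛ poch (suc (suc k)) (m ∸ suc k))
    ≈⟨ solve 3 (λ u t p → u :* (t :* p) := t :* (u :* p)) (λ _ → refl)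
               (1-q^ (suc k)) (monomial (i ℕ.+ e) (- s)) (poch (suc (suc k)) (m ∸ suc k)) ⟩
  monomial (i ℕ.+ e) (- s) ⊛ poch (suc k) (suc (m ∸ suc k))
    ≡⟨ cong (λ l → monomial (i ℕ.+ e) (- s) ⊛ poch (suc k) l) (sym (ℕ.+-∸-assoc 1 k<m)) ⟩
  monomial (i ℕ.+ e) (- s) ⊛ poch (suc k) (m ∸ k)
    ≈⟨ ⊛-congʳ (poch (suc k) (m ∸ k))
               (λ n → trans (sym (-ₛ-monomial (i ℕ.+ e) s n)) (cong -_ (sym (q^-⊛-monomial i e s n)))) ⟩
  (-ₛ (q^ i ⊛ monomial e s)) ⊛ poch (suc k) (m ∸ k)
    ≈⟨ solve 3 (λ x t p → (:- (x :* t)) :* p := :- (x :* (t :* p))) (λ _ → refl) (q^ i) (monomial e s) _ ⟩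
  -ₛ (q^ i ⊛ shanksTerm m k)
    ∎
  where
  open SetoidReasoning (CommutativeRing.setoid ℤ⟦q⟧)
  open SeriesSolver
  i = m ℕ.+ suc k
  e = shanksExp m k
  s = -1^ k

sumUpTo-shanksTerm-suc : ∀ m j → j ≤ m →
  sumUpTo j (shanksTerm (suc m)) ≈ sumUpTo j (shanksTerm m) -ₛ q^ (suc m ℕ.+ j) ⊛ shanksTerm m j
sumUpTo-shanksTerm-suc m zero _ = begin
  shanksTerm (suc m) 0                                ≈⟨ shanksTerm-sucˡ m 0 z≤n ⟩
  q^ 0 ⊛ (1-q^ (suc m) ⊛ shanksTerm m 0)              ≈⟨ solve 2 (λ y t → con (+ 1) :* ((con (+ 1) :- y) :* t) := t :- y :* t)
                                                                (λ _ → refl) (q^ (suc m)) (shanksTerm m 0) ⟩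
  shanksTerm m 0 -ₛ q^ (suc m) ⊛ shanksTerm m 0      ≡⟨ cong (λ i → shanksTerm m 0 -ₛ q^ i ⊛ shanksTerm m 0) (sym (ℕ.+-identityʳ (suc m))) ⟩
  shanksTerm m 0 -ₛ q^ (suc m ℕ.+ 0) ⊛ shanksTerm m 0 ∎
  where
  open SetoidReasoning (CommutativeRing.setoid ℤ⟦q⟧)
  open SeriesSolver
sumUpTo-shanksTerm-suc m (suc j) j<m = begin
  sumUpTo j (shanksTerm (suc m)) +ₛ shanksTerm (suc m) (suc j)
    ≈⟨ +ₛ-cong (sumUpTo-shanksTerm-suc m j (ℕ.<⇒≤ j<m)) (shanksTerm-sucˡ m (suc j) j<m) ⟩
  (S -ₛ q^ (suc m ℕ.+ j) ⊛ A) +ₛ q^ (suc j) ⊛ (1-q^ (suc m) ⊛ B)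
    ≈⟨ +ₛ-cong (+ₛ-cong {S} (λ _ → refl) telescoping) (λ _ → refl) ⟩
  (S +ₛ 1-q^ (suc j) ⊛ B) +ₛ q^ (suc j) ⊛ (1-q^ (suc m) ⊛ B)
    ≈⟨ solve 4 (λ S x y B → (S :+ (con (+ 1) :- x) :* B) :+ x :* ((con (+ 1) :- y) :* B) := (S :+ B) :- (y :* x) :* B)
               (λ _ → refl) S (q^ (suc j)) (q^ (suc m)) B ⟩
  (S +ₛ B) -ₛ (q^ (suc m) ⊛ q^ (suc j)) ⊛ B
    ≈⟨ +ₛ-cong {S +ₛ B} (λ _ → refl) (λ n → cong -_ (⊛-congʳ B (λ k → sym (q^-+ (suc m) (suc j) k)) n)) ⟩
  (S +ₛ B) -ₛ q^ (suc m ℕ.+ suc j) ⊛ B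
    ∎
  where
  open SetoidReasoning (CommutativeRing.setoid ℤ⟦q⟧)
  open SeriesSolver
  S = sumUpTo j (shanksTerm m)
  A = shanksTerm m j
  B = shanksTerm m (suc j)
  telescoping : -ₛ (q^ (suc m ℕ.+ j) ⊛ A) ≈ 1-q^ (suc j) ⊛ B
  telescoping n = sym (trans (1-q^-⊛-shanksTerm-suc m j j<m n) (cong (λ i → - (q^ i ⊛ A) n) (ℕ.+-suc m j)))

-- k (3k + 1) / 2
pentagonal : ℕ → ℕ
pentagonal k = shanksExp k k

-- Σ_{|j| ≤ n} (-1)^j q^(j(3j-1)/2): for j = m + 1 the exponent is 2m + 1 + pentagonal m,
-- for j = -(m + 1) it is pentagonal (m + 1).
pentagonalSum : ℕ → Series
pentagonalSum zero    = one
pentagonalSum (suc m) = pentagonalSum m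
                        +ₛ monomial (suc (m ℕ.+ m) ℕ.+ pentagonal m) (-1^ suc m)
                        +ₛ monomial (pentagonal (suc m)) (-1^ suc m)

shanksTerm-diagonal : ∀ m → shanksTerm m m ≈ monomial (pentagonal m) (-1^ m)
shanksTerm-diagonal m n =
  trans (⊛-congˡ (monomial (pentagonal m) (-1^ m)) (λ k → cong (λ l → poch (suc m) l k) (ℕ.n∸n≡0 m)) n)
        (⊛-identityʳ (monomial (pentagonal m) (-1^ m)) n)

shanksSum-suc : ∀ m → shanksSum (suc m) ≈ shanksSum m
  +ₛ monomial (suc (m ℕ.+ m) ℕ.+ pentagonal m) (-1^ suc m) +ₛ monomial (pentagonal (suc m)) (-1^ suc m)
shanksSum-suc m = +ₛ-cong
  (λ n → trans (sumUpTo-shanksTerm-suc m m ℕ.≤-refl n) (cong (λ x → shanksSum m n + x) (boundary n)))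
  (shanksTerm-diagonal (suc m))
  where
  boundary : -ₛ (q^ (suc m ℕ.+ m) ⊛ shanksTerm m m) ≈ monomial (suc (m ℕ.+ m) ℕ.+ pentagonal m) (-1^ suc m)
  boundary n = trans (cong -_ (trans (⊛-congˡ (q^ (suc m ℕ.+ m)) (shanksTerm-diagonal m) n)
                                     (q^-⊛-monomial (suc m ℕ.+ m) (pentagonal m) (-1^ m) n)))
                     (-ₛ-monomial (suc m ℕ.+ m ℕ.+ pentagonal m) (-1^ m) n)

shanks : ∀ n → shanksSum n ≈ pentagonalSum n
shanks zero    k = trans (monomial₀-⊛ (+ 1) one k) (ℤ.*-identityˡ (one k))
shanks (suc m) k = trans (shanksSum-suc m k) (cong (λ x → x + monomial e s k + monomial e′ s k) (shanks m k))
  where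
  s  = -1^ suc m
  e  = suc (m ℕ.+ m) ℕ.+ pentagonal m
  e′ = pentagonal (suc m)

shanksSum-coeff≡poch-coeff : ∀ N → shanksSum N N ≡ poch 1 N N
shanksSum-coeff≡poch-coeff N =
  trans (lower-terms N) (trans (monomial₀-⊛ (+ 1) (poch 1 N) N) (ℤ.*-identityˡ (poch 1 N N)))
  where
  lower-terms : ∀ j → sumUpTo j (shanksTerm N) N ≡ shanksTerm N 0 N
  lower-terms zero    = refl
  lower-terms (suc j) = trans (cong₂ _+_ (lower-terms j) vanishes) (ℤ.+-identityʳ (shanksTerm N 0 N))
    where
    N<exponent : N ℕ.< shanksExp N (suc j)
    N<exponent = ℕ.<-≤-trans (ℕ.m<m+n N (s≤s z≤n)) (ℕ.m≤m+n (N ℕ.+ suc j) (shanksExp N j))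
    vanishes : shanksTerm N (suc j) N ≡ + 0
    vanishes = monomial-⊛-below (shanksExp N (suc j)) (-1^ suc j) (poch (suc (suc j)) (N ∸ suc j)) N<exponent

euler-pentagonal : ∀ N → qPoch N ≡ pentagonalSum N N
euler-pentagonal N = begin
  qPochUpTo N N     ≡⟨ qPochUpTo≈poch N N ⟩
  poch 1 N N        ≡⟨ shanksSum-coeff≡poch-coeff N ⟨
  shanksSum N N     ≡⟨ shanks N N ⟩
  pentagonalSum N N ∎
  where open ≡-Reasoning

-- Coefficients of (q;q)_∞ at N with 24N + 1 exactly divisible by 5

infix 4 5∥_

5∥_ : ℕ → Set
5∥ n = 5 ∣ℕ n × 25 ∤ℕ n

5∥? : Decidable 5∥_
5∥? n = 5 ℕᵈ.∣? n ×-dec ¬? (25 ℕᵈ.∣? n)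

square-¬5∥ : ∀ x → ¬ 5∥ (x ℕ.* x)
square-¬5∥ x (5∣x² , 25∤x²) = 25∤x² (ℕᵈ.*-pres-∣ 5∣x 5∣x)
  where
  5∣x : 5 ∣ℕ x
  5∣x = [ id , id ]′ (euclidsLemma x x (from-yes (prime? 5)) 5∣x²)

5∥-+-multiple-of-25 : ∀ {a b} → 25 ∣ℕ a → 5∥ (a ℕ.+ b) ⇔ 5∥ b
5∥-+-multiple-of-25 {a} {b} 25∣a = mk⇔
  (λ (5∣a+b , 25∤a+b) → ℕᵈ.∣m+n∣m⇒∣n 5∣a+b 5∣a , 25∤a+b ∘ ℕᵈ.∣m∣n⇒∣m+n 25∣a)
  (λ (5∣b , 25∤b) → ℕᵈ.∣m∣n⇒∣m+n 5∣a 5∣b , 25∤b ∘ flip ℕᵈ.∣m+n∣m⇒∣n 25∣a)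
  where
  5∣a : 5 ∣ℕ a
  5∣a = ℕᵈ.∣-trans (ℕᵈ.divides 5 refl) 25∣a

pentagonal-square : ∀ k → 24 ℕ.* pentagonal k ℕ.+ 1 ≡ (6 ℕ.* k ℕ.+ 1) ℕ.* (6 ℕ.* k ℕ.+ 1)
pentagonal-square k = begin
  24 ℕ.* pentagonal k ℕ.+ 1                    ≡⟨ halve (pentagonal k) ⟩
  12 ℕ.* (2 ℕ.* pentagonal k) ℕ.+ 1            ≡⟨ cong (λ d → 12 ℕ.* d ℕ.+ 1) (shanksExp-double k k) ⟩
  12 ℕ.* (k ℕ.* (2 ℕ.* k ℕ.+ suc k)) ℕ.+ 1     ≡⟨ complete-square k ⟩
  (6 ℕ.* k ℕ.+ 1) ℕ.* (6 ℕ.* k ℕ.+ 1)          ∎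
  where
  open ≡-Reasoning
  halve : ∀ e → 24 ℕ.* e ℕ.+ 1 ≡ 12 ℕ.* (2 ℕ.* e) ℕ.+ 1
  halve = ℕ-solve-∀
  complete-square : ∀ k → 12 ℕ.* (k ℕ.* (2 ℕ.* k ℕ.+ suc k)) ℕ.+ 1 ≡ (6 ℕ.* k ℕ.+ 1) ℕ.* (6 ℕ.* k ℕ.+ 1)
  complete-square = ℕ-solve-∀

pentagonal′-square : ∀ k →
  24 ℕ.* (suc (k ℕ.+ k) ℕ.+ pentagonal k) ℕ.+ 1 ≡ (6 ℕ.* k ℕ.+ 5) ℕ.* (6 ℕ.* k ℕ.+ 5)
pentagonal′-square k = begin
  24 ℕ.* (suc (k ℕ.+ k) ℕ.+ pentagonal k) ℕ.+ 1           ≡⟨ shift k (pentagonal k) ⟩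
  24 ℕ.* pentagonal k ℕ.+ 1 ℕ.+ 24 ℕ.* suc (k ℕ.+ k)       ≡⟨ cong (ℕ._+ 24 ℕ.* suc (k ℕ.+ k)) (pentagonal-square k) ⟩
  (6 ℕ.* k ℕ.+ 1) ℕ.* (6 ℕ.* k ℕ.+ 1) ℕ.+ 24 ℕ.* suc (k ℕ.+ k) ≡⟨ complete-square k ⟩
  (6 ℕ.* k ℕ.+ 5) ℕ.* (6 ℕ.* k ℕ.+ 5)                     ∎
  where
  open ≡-Reasoning
  shift : ∀ k e → 24 ℕ.* (suc (k ℕ.+ k) ℕ.+ e) ℕ.+ 1 ≡ 24 ℕ.* e ℕ.+ 1 ℕ.+ 24 ℕ.* suc (k ℕ.+ k)
  shift = ℕ-solve-∀
  complete-square : ∀ k →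
    (6 ℕ.* k ℕ.+ 1) ℕ.* (6 ℕ.* k ℕ.+ 1) ℕ.+ 24 ℕ.* suc (k ℕ.+ k) ≡ (6 ℕ.* k ℕ.+ 5) ℕ.* (6 ℕ.* k ℕ.+ 5)
  complete-square = ℕ-solve-∀

5∥⇒≢-square-exponent : ∀ {N e} x → 24 ℕ.* e ℕ.+ 1 ≡ x ℕ.* x → 5∥ (24 ℕ.* N ℕ.+ 1) → N ≢ e
5∥⇒≢-square-exponent x square 5∥N refl = square-¬5∥ x (subst 5∥_ square 5∥N)

pentagonalSum-5∥ : ∀ {N} → 5∥ (24 ℕ.* N ℕ.+ 1) → ∀ n → pentagonalSum n N ≡ + 0
pentagonalSum-5∥ {zero}  5∥N zero = contradiction 5∥N (square-¬5∥ 1)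
pentagonalSum-5∥ {suc N} 5∥N zero = refl
pentagonalSum-5∥ {N}     5∥N (suc m) =
  cong₂ _+_ (cong₂ _+_ (pentagonalSum-5∥ 5∥N m) (monomial-≢ e s {N} N≢e)) (monomial-≢ e′ s {N} N≢e′)
  where
  s  = -1^ suc m
  e  = suc (m ℕ.+ m) ℕ.+ pentagonal m
  e′ = pentagonal (suc m)
  N≢e : N ≢ e
  N≢e = 5∥⇒≢-square-exponent (6 ℕ.* m ℕ.+ 5) (pentagonal′-square m) 5∥N
  N≢e′ : N ≢ e′
  N≢e′ = 5∥⇒≢-square-exponent (6 ℕ.* suc m ℕ.+ 1) (pentagonal-square (suc m)) 5∥N

qPoch-5∥ : ∀ {N} → 5∥ (24 ℕ.* N ℕ.+ 1) → qPoch N ≡ + 0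
qPoch-5∥ {N} 5∥N = trans (euler-pentagonal N) (pentagonalSum-5∥ 5∥N N)

⊛-qPoch-5∥ : ∀ h {N} → h ∈ℤ⟦q^ 25 ⟧[mod + 5 ] → 5∥ (24 ℕ.* N ℕ.+ 1) → + 5 ∣ (h ⊛ qPoch) N
⊛-qPoch-5∥ h {N} h∈ 5∥N = ⊛-∣-termwise (+ 5) h qPoch N term
  where
  term : ∀ i j → i ℕ.+ j ≡ N → + 5 ∣ h i * qPoch j
  term i j i+j≡N with 25 ℕᵈ.∣? i
  ... | no 25∤i  = ∣m⇒∣m*n (qPoch j) (h∈ i 25∤i)
  ... | yes 25∣i = subst (λ x → + 5 ∣ h i * x) (sym (qPoch-5∥ {j} 5∥j))
                         (subst (+ 5 ∣_) (sym (ℤ.*-zeroʳ (h i))) (∣0 (+ 5)))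
    where
    5∥j : 5∥ (24 ℕ.* j ℕ.+ 1)
    5∥j = Equivalence.to (5∥-+-multiple-of-25 (ℕᵈ.∣n⇒∣m*n 24 25∣i))
            (subst 5∥_ (trans (cong (λ n → 24 ℕ.* n ℕ.+ 1) (sym i+j≡N)) (regroup i j)) 5∥N)
      where
      regroup : ∀ i j → 24 ℕ.* (i ℕ.+ j) ℕ.+ 1 ≡ 24 ℕ.* i ℕ.+ (24 ℕ.* j ℕ.+ 1)
      regroup = ℕ-solve-∀

ramanujanP-factorisation : ∀ λ′ →
  ∃[ h ] (h ∈ℤ⟦q^ 25 ⟧[mod + 5 ] × ramanujanP (- (+ 25 * λ′ + + 1)) ≈ h ⊛ qPoch)
ramanujanP-factorisation (+ k) =
  pow (pow qPoch 25) k , pow-∈ℤ⟦q^⟧ (pow qPoch 25) k (pow²⁵-∈ℤ⟦q²⁵⟧ qPoch) ,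
  λ n → trans (cong (λ r → ramanujanP r n) r≡) (pow-suc-* qPoch 25 k n)
  where
  r≡ : - (+ 25 * + k + + 1) ≡ -[1+ 25 ℕ.* k ]
  r≡ = cong (λ a → - (a + + 1)) (sym (ℤ.pos-* 25 k)) ⟨ trans ⟩ cong (λ a → - (+ a)) (ℕ.+-comm (25 ℕ.* k) 1)
ramanujanP-factorisation -[1+ j ] =
  pow (pow (inv qPoch) 25) (suc j) , pow-∈ℤ⟦q^⟧ (pow (inv qPoch) 25) (suc j) (pow²⁵-∈ℤ⟦q²⁵⟧ (inv qPoch)) ,
  λ n → trans (cong (λ r → ramanujanP r n) r≡) (pow-*-pred (inv qPoch) qPoch 25 24 j refl inv-qPoch n)
  where
  r≡ : - (+ 25 * -[1+ j ] + + 1) ≡ + (25 ℕ.* j ℕ.+ 24)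
  r≡ = trans (negate (+ j)) (trans (cong (_+ + 24) (sym (ℤ.pos-* 25 j))) (sym (ℤ.pos-+ (25 ℕ.* j) 24)))
    where
    negate : ∀ x → - (+ 25 * (- (+ 1 + x)) + + 1) ≡ + 25 * x + + 24
    negate = solve-∀
  inv-qPoch : inv qPoch ⊛ qPoch ≈ one
  inv-qPoch n = trans (⊛-comm (inv qPoch) qPoch n) (⊛-inv qPoch refl n)

5∥24[25n+5ℓ+1]+1 : ∀ n ℓ → 1 ≤ ℓ → ℓ ≤ 4 → 5∥ (24 ℕ.* (25 ℕ.* n ℕ.+ 5 ℕ.* ℓ ℕ.+ 1) ℕ.+ 1)
5∥24[25n+5ℓ+1]+1 n ℓ 1≤ℓ ℓ≤4 = subst 5∥_ (sym (regroup n ℓ))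
  (Equivalence.from (5∥-+-multiple-of-25 (ℕᵈ.∣m⇒∣m*n (24 ℕ.* n) ℕᵈ.∣-refl)) (residue ℓ 1≤ℓ ℓ≤4))
  where
  regroup : ∀ n ℓ → 24 ℕ.* (25 ℕ.* n ℕ.+ 5 ℕ.* ℓ ℕ.+ 1) ℕ.+ 1 ≡ 25 ℕ.* (24 ℕ.* n) ℕ.+ (120 ℕ.* ℓ ℕ.+ 25)
  regroup = ℕ-solve-∀
  residue : ∀ ℓ → 1 ≤ ℓ → ℓ ≤ 4 → 5∥ (120 ℕ.* ℓ ℕ.+ 25)
  residue 1 _ _ = from-yes (5∥? 145)
  residue 2 _ _ = from-yes (5∥? 265)
  residue 3 _ _ = from-yes (5∥? 385)
  residue 4 _ _ = from-yes (5∥? 505)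
  residue (suc (suc (suc (suc (suc _))))) _ (s≤s (s≤s (s≤s (s≤s ()))))

-- The hypothesis 25λ′ + 1 ≢ 0 always holds.
theorem1p4 : (λ′ : ℤ) → (+ 25 * λ′ + + 1) ≢ + 0 → (n ℓ : ℕ) → 1 ≤ ℓ → ℓ ≤ 4 →
    + 5 Unsigned.∣ ramanujanP (- (+ 25 * λ′ + + 1)) (25 ℕ.* n ℕ.+ 5 ℕ.* ℓ ℕ.+ 1)
theorem1p4 λ′ _ n ℓ 1≤ℓ ℓ≤4 with ramanujanP-factorisation λ′
... | h , h∈ℤ⟦q²⁵⟧ , ramanujanP≈h⊛qPoch =
  ∣⇒∣ᵤ (subst (+ 5 ∣_) (sym (ramanujanP≈h⊛qPoch N)) (⊛-qPoch-5∥ h {N} h∈ℤ⟦q²⁵⟧ 5∥24N+1))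
  where
  N = 25 ℕ.* n ℕ.+ 5 ℕ.* ℓ ℕ.+ 1
  5∥24N+1 : 5∥ (24 ℕ.* N ℕ.+ 1)
  5∥24N+1 = 5∥24[25n+5ℓ+1]+1 n ℓ 1≤ℓ ℓ≤4
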